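{- Let $b\ge2$ and $N\ge1$. The matrices $U_N$ and $V_N$ satisfy \[ U_N^{b+1}=V_N^{b+1}=(-1)^{N(b+1)}I_{b^N}, \] where $I_{b^N}$ is the $b^N\times b^N$ identity matrix.
   Context: $\otimes$ is the Kronecker product. $M_1$ is the $b\times b$ lower-bidiagonal matrix with all diagonal entries $1$, all entries directly below the diagonal equal to $-1$, and all other entries $0$; $M_{N+1}=M_1\otimes M_N$. $S_1$ is the $b\times b$ lower-triangular matrix with all entries on and below the diagonal equal to $1$ and others $0$; $S_{N+1}=S_1\otimes S_N$. $T_N=M_N^t$ is the transpose of $M_N$, $U_N=S_NT_N$ and $V_N=T_NS_N$. -}

module Defs where

open import Data.Nat as ℕ using (ℕ; zero; suc; _<ᵇ_; _≡ᵇ_)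
open import Data.Fin as Fin using (Fin; toℕ; remQuot)
open import Data.Integer as ℤ using (ℤ; 0ℤ; 1ℤ; -1ℤ; _+_; _*_)
open import Data.Product using (_,_)
open import Data.Bool using (if_then_else_)

Mat : ℕ → Set
Mat n = Fin n → Fin n → ℤ

∑ : ∀ {n} → (Fin n → ℤ) → ℤ
∑ {zero}  f = 0ℤ
∑ {suc n} f = f Fin.zero + ∑ (λ i → f (Fin.suc i))

_·_ : ∀ {n} → Mat n → Mat n → Mat n
(A · B) i j = ∑ (λ k → A i k * B k j)

transpose : ∀ {n} → Mat n → Mat n
transpose A i j = A j i

I : ∀ n → Mat n
I n i j = if toℕ i ≡ᵇ toℕ j then 1ℤ else 0ℤ

_^_ : ∀ {n} → Mat n → ℕ → Mat n
_^_ {n} A zero    = I n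
_^_ {n} A (suc k) = A · (A ^ k)

_•_ : ∀ {n} → ℤ → Mat n → Mat n
(c • A) i j = c * A i j

-- Kronecker product; the index combine i j (= i*n + j) of Fin (m * n)
-- corresponds to the pair (i , j)  (standard ordering).
_⊗_ : ∀ {m n} → Mat m → Mat n → Mat (m ℕ.* n)
_⊗_ {m} {n} A B p q with remQuot {m} n p | remQuot {m} n q
... | i₁ , j₁ | i₂ , j₂ = A i₁ i₂ * B j₁ j₂

sgn : ℕ → ℤ
sgn zero    = 1ℤ
sgn (suc k) = -1ℤ * sgn k

M₁ : ∀ b → Mat b
M₁ b i j = if toℕ i ≡ᵇ toℕ j then 1ℤ
           else if toℕ i ≡ᵇ suc (toℕ j) then -1ℤ else 0ℤ

S₁ : ∀ b → Mat b
S₁ b i j = if toℕ i <ᵇ toℕ j then 0ℤ else 1ℤ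

kpow : ∀ b → Mat b → (N : ℕ) → Mat (b ℕ.^ N)
kpow b A zero    = I 1
kpow b A (suc N) = A ⊗ kpow b A N

-- Only used for N ≥ 1 (for N = 1, this is A ⊗ I₁, entrywise equal to A).
M : ∀ b N → Mat (b ℕ.^ N)
M b N = kpow b (M₁ b) N

S : ∀ b N → Mat (b ℕ.^ N)
S b N = kpow b (S₁ b) N

T : ∀ b N → Mat (b ℕ.^ N)
T b N = transpose (M b N)

U : ∀ b N → Mat (b ℕ.^ N)
U b N = S b N · T b N

V : ∀ b N → Mat (b ℕ.^ N)
V b N = T b N · S b N

-- U_N = S_N T_N and V_N = T_N S_N are the N-th Kronecker powers of U₁ = S₁ M₁ᵗ and V₁ = M₁ᵗ S₁
-- (mixed-product rule), so (−1)^{b+1} I for N = 1 lifts to (−1)^{N(b+1)} I. For N = 1, telescoping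
-- gives U₁ (y i − y b)ᵢ = (y 0 − y (i+1))ᵢ: reading ℤ^b as ℤ^{b+1} modulo constant vectors, with
-- coordinate b normalised to 0, U₁ is minus the cyclic shift of the b+1 coordinates, so
-- U₁^{b+1} = (−1)^{b+1} I. Finally V₁ M₁ᵗ = M₁ᵗ U₁ and M₁ᵗ S₁ᵗ = I, so V₁ is similar to U₁.
module Submission where

open import Defs

-- ℤ arithmetic is opened only inside this module, so that the statement at the end can use
-- ℕ's _+_ and _*_ unqualified.
module _ where
  open import Data.Nat as ℕ using (ℕ; zero; suc)
  import Data.Nat.Properties as ℕP
  open import Data.Nat.DivMod using (_%_; m≤n⇒m%n≡m; %-remove-+ˡ)
  open import Data.Nat.Divisibility using (∣-refl)
  open import Data.Integer using (ℤ; 0ℤ; 1ℤ; -1ℤ; _+_; _*_; -_; _-_)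
  import Data.Integer.Properties as ℤP
  open import Data.Integer.Tactic.RingSolver using (solve-∀)
  open import Data.Bool using (false; if_then_else_)
  open import Data.Bool.Properties using (T-≡)
  open import Data.Fin using (Fin; zero; suc; toℕ; combine; remQuot; _↑ˡ_; _↑ʳ_)
  open import Data.Fin.Properties using (toℕ<n; combine-remQuot; remQuot-combine)
  open import Data.Product using (proj₁; proj₂; uncurry)
  open import Function using (_∘_; Equivalence)
  open import Relation.Binary.Bundles using (Setoid)
  import Relation.Binary.Reasoning.Setoid as SetoidReasoning
  open import Relation.Binary.PropositionalEquality
    using (_≡_; refl; sym; trans; cong; cong₂; subst; _≗_; module ≡-Reasoning)
  open import Algebra.Properties.Semiring.Sum ℤP.+-*-semiring
    using (sum; sum-cong-≗; ∑-comm; *-distribˡ-sum)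

  ∑≡sum : ∀ {n} (f : Fin n → ℤ) → ∑ f ≡ sum f
  ∑≡sum {zero}  f = refl
  ∑≡sum {suc n} f = cong (f zero +_) (∑≡sum (f ∘ suc))

  ∑-cong : ∀ {n} {f g : Fin n → ℤ} → f ≗ g → ∑ f ≡ ∑ g
  ∑-cong {f = f} {g} f≗g = begin
    ∑ f   ≡⟨ ∑≡sum f ⟩
    sum f ≡⟨ sum-cong-≗ f≗g ⟩
    sum g ≡⟨ ∑≡sum g ⟨
    ∑ g   ∎
    where open ≡-Reasoning

  ∑-*ˡ : ∀ {n} c (f : Fin n → ℤ) → ∑ (λ i → c * f i) ≡ c * ∑ f
  ∑-*ˡ c f = begin
    ∑ (λ i → c * f i)   ≡⟨ ∑≡sum (λ i → c * f i) ⟩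
    sum (λ i → c * f i) ≡⟨ *-distribˡ-sum c f ⟨
    c * sum f           ≡⟨ cong (c *_) (∑≡sum f) ⟨
    c * ∑ f             ∎
    where open ≡-Reasoning

  ∑-*ʳ : ∀ {n} c (f : Fin n → ℤ) → ∑ (λ i → f i * c) ≡ ∑ f * c
  ∑-*ʳ c f = trans (∑-cong (λ i → ℤP.*-comm (f i) c)) (trans (∑-*ˡ c f) (ℤP.*-comm c (∑ f)))

  ∑-zero : ∀ {n} (f : Fin n → ℤ) → ∑ (λ i → 0ℤ * f i) ≡ 0ℤ
  ∑-zero f = trans (∑-*ˡ 0ℤ f) (ℤP.*-zeroˡ (∑ f))

  ∑-swap : ∀ {m n} (f : Fin m → Fin n → ℤ) → ∑ (λ i → ∑ (f i)) ≡ ∑ (λ j → ∑ (λ i → f i j))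
  ∑-swap f = begin
    ∑ (λ i → ∑ (f i))              ≡⟨ ∑≡sum (λ i → ∑ (f i)) ⟩
    sum (λ i → ∑ (f i))            ≡⟨ sum-cong-≗ (λ i → ∑≡sum (f i)) ⟩
    sum (λ i → sum (f i))          ≡⟨ ∑-comm f ⟩
    sum (λ j → sum (λ i → f i j))  ≡⟨ sum-cong-≗ (λ j → ∑≡sum (λ i → f i j)) ⟨
    sum (λ j → ∑ (λ i → f i j))    ≡⟨ ∑≡sum (λ j → ∑ (λ i → f i j)) ⟨
    ∑ (λ j → ∑ (λ i → f i j))      ∎
    where open ≡-Reasoning

  ∑-↑ : ∀ m {n} (f : Fin (m ℕ.+ n) → ℤ) → ∑ f ≡ ∑ (λ i → f (i ↑ˡ n)) + ∑ (λ j → f (m ↑ʳ j))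
  ∑-↑ zero    f = sym (ℤP.+-identityˡ _)
  ∑-↑ (suc m) f = trans (cong (f zero +_) (∑-↑ m (f ∘ suc))) (sym (ℤP.+-assoc (f zero) _ _))

  ∑-combine : ∀ m {n} (f : Fin (m ℕ.* n) → ℤ) → ∑ f ≡ ∑ (λ i → ∑ (λ j → f (combine {m} {n} i j)))
  ∑-combine zero        f = refl
  ∑-combine (suc m) {n} f =
    trans (∑-↑ n f) (cong (∑ (λ j → f (j ↑ˡ (m ℕ.* n))) +_) (∑-combine m (λ k → f (n ↑ʳ k))))

  infix 4 _≋_
  _≋_ : ∀ {n} → Mat n → Mat n → Set
  A ≋ B = ∀ i j → A i j ≡ B i j

  ≋-refl : ∀ {n} {A : Mat n} → A ≋ A
  ≋-refl i j = refl

  ≋-sym : ∀ {n} {A B : Mat n} → A ≋ B → B ≋ A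
  ≋-sym A≋B i j = sym (A≋B i j)

  ≋-trans : ∀ {n} {A B C : Mat n} → A ≋ B → B ≋ C → A ≋ C
  ≋-trans A≋B B≋C i j = trans (A≋B i j) (B≋C i j)

  ≋-setoid : ℕ → Setoid _ _
  ≋-setoid n = record
    { Carrier       = Mat n
    ; _≈_           = _≋_
    ; isEquivalence = record { refl = ≋-refl ; sym = ≋-sym ; trans = ≋-trans }
    }

  module ≋-Reasoning {n} = SetoidReasoning (≋-setoid n)

  infixr 7 _▸_
  _▸_ : ∀ {n} → Mat n → (Fin n → ℤ) → Fin n → ℤ
  (A ▸ x) i = ∑ (λ l → A i l * x l)

  column : ∀ {n} → Mat n → Fin n → Fin n → ℤ
  column A j l = A l j

  ▸-cong : ∀ {n} (A : Mat n) {x y : Fin n → ℤ} → x ≗ y → A ▸ x ≗ A ▸ y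
  ▸-cong A x≗y i = ∑-cong (λ l → cong (A i l *_) (x≗y l))

  ▸-* : ∀ {n} (A : Mat n) c (x : Fin n → ℤ) → A ▸ (λ l → c * x l) ≗ λ i → c * (A ▸ x) i
  ▸-* A c x i = trans (∑-cong (λ l → swap (A i l) c (x l))) (∑-*ˡ c (λ l → A i l * x l))
    where
    swap : ∀ a c x → a * (c * x) ≡ c * (a * x)
    swap = solve-∀

  I-▸ : ∀ {n} (x : Fin n → ℤ) → I n ▸ x ≗ x
  I-▸ {suc n} x zero = begin
    1ℤ * x zero + ∑ (λ l → 0ℤ * x (suc l)) ≡⟨ cong₂ _+_ (ℤP.*-identityˡ (x zero)) (∑-zero (x ∘ suc)) ⟩
    x zero + 0ℤ                            ≡⟨ ℤP.+-identityʳ (x zero) ⟩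
    x zero                                 ∎
    where open ≡-Reasoning
  I-▸ {suc n} x (suc i) = begin
    0ℤ * x zero + (I n ▸ x ∘ suc) i ≡⟨ cong₂ _+_ (ℤP.*-zeroˡ (x zero)) (I-▸ (x ∘ suc) i) ⟩
    0ℤ + x (suc i)                  ≡⟨ ℤP.+-identityˡ (x (suc i)) ⟩
    x (suc i)                       ∎
    where open ≡-Reasoning

  ·-▸ : ∀ {n} (A B : Mat n) (x : Fin n → ℤ) → (A · B) ▸ x ≗ A ▸ (B ▸ x)
  ·-▸ A B x i = begin
    ∑ (λ l → ∑ (λ k → A i k * B k l) * x l)   ≡⟨ ∑-cong (λ l → ∑-*ʳ (x l) (λ k → A i k * B k l)) ⟨
    ∑ (λ l → ∑ (λ k → A i k * B k l * x l))   ≡⟨ ∑-swap (λ l k → A i k * B k l * x l) ⟩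
    ∑ (λ k → ∑ (λ l → A i k * B k l * x l))   ≡⟨ ∑-cong (λ k → ∑-cong (λ l → ℤP.*-assoc (A i k) (B k l) (x l))) ⟩
    ∑ (λ k → ∑ (λ l → A i k * (B k l * x l))) ≡⟨ ∑-cong (λ k → ∑-*ˡ (A i k) (λ l → B k l * x l)) ⟩
    ∑ (λ k → A i k * (B ▸ x) k)               ∎
    where open ≡-Reasoning

  ·-assoc : ∀ {n} (A B C : Mat n) → (A · B) · C ≋ A · (B · C)
  ·-assoc A B C i j = ·-▸ A B (column C j) i

  ·-cong : ∀ {n} {A A′ B B′ : Mat n} → A ≋ A′ → B ≋ B′ → A · B ≋ A′ · B′
  ·-cong A≋A′ B≋B′ i j = ∑-cong (λ k → cong₂ _*_ (A≋A′ i k) (B≋B′ k j))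

  ·-congˡ : ∀ {n} (A : Mat n) {B B′ : Mat n} → B ≋ B′ → A · B ≋ A · B′
  ·-congˡ A B≋B′ = ·-cong {A = A} ≋-refl B≋B′

  ·-congʳ : ∀ {n} (B : Mat n) {A A′ : Mat n} → A ≋ A′ → A · B ≋ A′ · B
  ·-congʳ B A≋A′ = ·-cong {B = B} A≋A′ ≋-refl

  ·-identityˡ : ∀ {n} (A : Mat n) → I n · A ≋ A
  ·-identityˡ A i j = I-▸ (column A j) i

  ·-identityʳ : ∀ {n} (A : Mat n) → A · I n ≋ A
  ·-identityʳ A i = row-I (A i)
    where
    row-I : ∀ {n} (x : Fin n → ℤ) j → ∑ (λ k → x k * I n k j) ≡ x j
    row-I {suc n} x zero = begin
      x zero * 1ℤ + ∑ (λ k → x (suc k) * 0ℤ) ≡⟨ cong₂ _+_ (ℤP.*-identityʳ (x zero)) (∑-*ʳ 0ℤ (x ∘ suc)) ⟩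
      x zero + ∑ (x ∘ suc) * 0ℤ              ≡⟨ cong (x zero +_) (ℤP.*-zeroʳ (∑ (x ∘ suc))) ⟩
      x zero + 0ℤ                            ≡⟨ ℤP.+-identityʳ (x zero) ⟩
      x zero                                 ∎
      where open ≡-Reasoning
    row-I {suc n} x (suc j) = begin
      x zero * 0ℤ + ∑ (λ k → x (suc k) * I n k j) ≡⟨ cong₂ _+_ (ℤP.*-zeroʳ (x zero)) (row-I (x ∘ suc) j) ⟩
      0ℤ + x (suc j)                              ≡⟨ ℤP.+-identityˡ (x (suc j)) ⟩
      x (suc j)                                   ∎
      where open ≡-Reasoning

  •-cong : ∀ {n} c {A B : Mat n} → A ≋ B → c • A ≋ c • B
  •-cong c A≋B i j = cong (c *_) (A≋B i j)

  •-· : ∀ {n} c (A B : Mat n) → (c • A) · B ≋ c • (A · B)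
  •-· c A B i j = trans (∑-cong (λ l → ℤP.*-assoc c (A i l) (B l j))) (∑-*ˡ c (λ l → A i l * B l j))

  ·-• : ∀ {n} c (A B : Mat n) → A · (c • B) ≋ c • (A · B)
  ·-• c A B i j = ▸-* A c (column B j) i

  ^-cong : ∀ {n} {A B : Mat n} k → A ≋ B → A ^ k ≋ B ^ k
  ^-cong zero    A≋B i j = refl
  ^-cong (suc k) A≋B     = ·-cong A≋B (^-cong k A≋B)

  ^-intertwine : ∀ {n} {A B X : Mat n} → A · X ≋ X · B → ∀ k → (A ^ k) · X ≋ X · (B ^ k)
  ^-intertwine {n} {A} {B} {X} AX≋XB zero = begin
    I n · X ≈⟨ ·-identityˡ X ⟩
    X       ≈⟨ ·-identityʳ X ⟨
    X · I n ∎
    where open ≋-Reasoning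
  ^-intertwine {n} {A} {B} {X} AX≋XB (suc k) = begin
    (A · (A ^ k)) · X ≈⟨ ·-assoc A (A ^ k) X ⟩
    A · ((A ^ k) · X) ≈⟨ ·-congˡ A (^-intertwine AX≋XB k) ⟩
    A · (X · (B ^ k)) ≈⟨ ·-assoc A X (B ^ k) ⟨
    (A · X) · (B ^ k) ≈⟨ ·-congʳ (B ^ k) AX≋XB ⟩
    (X · B) · (B ^ k) ≈⟨ ·-assoc X B (B ^ k) ⟩
    X · (B · (B ^ k)) ∎
    where open ≋-Reasoning

  ^-similar : ∀ {n} {A B X Y : Mat n} {c k} → A · X ≋ X · B → X · Y ≋ I n →
              B ^ k ≋ c • I n → A ^ k ≋ c • I n
  ^-similar {n} {A} {B} {X} {Y} {c} {k} AX≋XB XY≋I Bᵏ≋cI = begin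
    A ^ k                 ≈⟨ ·-identityʳ (A ^ k) ⟨
    (A ^ k) · I n         ≈⟨ ·-congˡ (A ^ k) XY≋I ⟨
    (A ^ k) · (X · Y)     ≈⟨ ·-assoc (A ^ k) X Y ⟨
    ((A ^ k) · X) · Y     ≈⟨ ·-congʳ Y (^-intertwine AX≋XB k) ⟩
    (X · (B ^ k)) · Y     ≈⟨ ·-congʳ Y (·-congˡ X Bᵏ≋cI) ⟩
    (X · (c • I n)) · Y   ≈⟨ ·-congʳ Y (·-• c X (I n)) ⟩
    (c • (X · I n)) · Y   ≈⟨ ·-congʳ Y (•-cong c (·-identityʳ X)) ⟩
    (c • X) · Y           ≈⟨ •-· c X Y ⟩
    c • (X · Y)           ≈⟨ •-cong c XY≋I ⟩
    c • I n               ∎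
    where open ≋-Reasoning

  -- Kronecker products and Kronecker powers

  ⊗-remQuot : ∀ {m n} (A : Mat m) (B : Mat n) p q →
              (A ⊗ B) p q ≡ A (proj₁ (remQuot {m} n p)) (proj₁ (remQuot {m} n q))
                          * B (proj₂ (remQuot {m} n p)) (proj₂ (remQuot {m} n q))
  ⊗-remQuot {m} {n} A B p q with remQuot {m} n p | remQuot {m} n q
  ... | _ | _ = refl

  ⊗-combine : ∀ {m n} (A : Mat m) (B : Mat n) i j k l →
              (A ⊗ B) (combine i j) (combine k l) ≡ A i k * B j l
  ⊗-combine {m} {n} A B i j k l = trans (⊗-remQuot A B (combine i j) (combine k l))
    (cong₂ (λ x y → A (proj₁ x) (proj₁ y) * B (proj₂ x) (proj₂ y))
           (remQuot-combine {m} {n} i j) (remQuot-combine {m} {n} k l))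

  ∀-combine : ∀ {m n} {P : Fin (m ℕ.* n) → Set} → (∀ i j → P (combine i j)) → ∀ p → P p
  ∀-combine {m} {n} {P} P-combine p =
    subst P (combine-remQuot {m} n p) (uncurry P-combine (remQuot {m} n p))

  ⊗-ext : ∀ {m n} {X Y : Mat (m ℕ.* n)} →
          (∀ i j k l → X (combine i j) (combine k l) ≡ Y (combine i j) (combine k l)) → X ≋ Y
  ⊗-ext {m} {n} X≡Y = ∀-combine {m} {n} λ i j → ∀-combine {m} {n} λ k l → X≡Y i j k l

  ⊗-cong : ∀ {m n} {A A′ : Mat m} {B B′ : Mat n} → A ≋ A′ → B ≋ B′ → A ⊗ B ≋ A′ ⊗ B′
  ⊗-cong {m} {n} {A} {A′} {B} {B′} A≋A′ B≋B′ = ⊗-ext {m} {n} λ i j k l → begin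
    (A ⊗ B) (combine i j) (combine k l)   ≡⟨ ⊗-combine A B i j k l ⟩
    A i k * B j l                         ≡⟨ cong₂ _*_ (A≋A′ i k) (B≋B′ j l) ⟩
    A′ i k * B′ j l                       ≡⟨ ⊗-combine A′ B′ i j k l ⟨
    (A′ ⊗ B′) (combine i j) (combine k l) ∎
    where open ≡-Reasoning

  ⊗-transpose : ∀ {m n} (A : Mat m) (B : Mat n) → transpose (A ⊗ B) ≋ transpose A ⊗ transpose B
  ⊗-transpose {m} {n} A B = ⊗-ext {m} {n} λ i j k l →
    trans (⊗-combine A B k l i j) (sym (⊗-combine (transpose A) (transpose B) i j k l))

  •-⊗-• : ∀ {m n} c d (A : Mat m) (B : Mat n) → (c • A) ⊗ (d • B) ≋ (c * d) • (A ⊗ B)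
  •-⊗-• {m} {n} c d A B = ⊗-ext {m} {n} λ i j k l → begin
    ((c • A) ⊗ (d • B)) (combine i j) (combine k l) ≡⟨ ⊗-combine (c • A) (d • B) i j k l ⟩
    c * A i k * (d * B j l)                         ≡⟨ interchange c (A i k) d (B j l) ⟩
    c * d * (A i k * B j l)                         ≡⟨ cong (c * d *_) (⊗-combine A B i j k l) ⟨
    c * d * (A ⊗ B) (combine i j) (combine k l)     ∎
    where
    open ≡-Reasoning
    interchange : ∀ c a d b → c * a * (d * b) ≡ c * d * (a * b)
    interchange = solve-∀

  ⊗-▸ : ∀ {m n} (A : Mat m) (B : Mat n) (x : Fin (m ℕ.* n) → ℤ) i j →
        ((A ⊗ B) ▸ x) (combine i j) ≡ (A ▸ (λ k → (B ▸ (λ l → x (combine k l))) j)) i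
  ⊗-▸ {m} {n} A B x i j = begin
    ∑ (λ q → (A ⊗ B) (combine i j) q * x q)
      ≡⟨ ∑-combine m {n} (λ q → (A ⊗ B) (combine i j) q * x q) ⟩
    ∑ (λ (k : Fin m) → ∑ (λ (l : Fin n) → (A ⊗ B) (combine i j) (combine k l) * x (combine k l)))
      ≡⟨ ∑-cong (λ k → ∑-cong (λ l → cong (_* x (combine k l)) (⊗-combine A B i j k l))) ⟩
    ∑ (λ k → ∑ (λ l → A i k * B j l * x (combine k l)))
      ≡⟨ ∑-cong (λ k → trans (∑-cong (λ l → ℤP.*-assoc (A i k) (B j l) (x (combine k l))))
                             (∑-*ˡ (A i k) (λ l → B j l * x (combine k l)))) ⟩
    ∑ (λ k → A i k * ∑ (λ l → B j l * x (combine k l))) ∎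
    where open ≡-Reasoning

  ⊗-· : ∀ {m n} (A C : Mat m) (B D : Mat n) → (A ⊗ B) · (C ⊗ D) ≋ (A · C) ⊗ (B · D)
  ⊗-· {m} {n} A C B D = ⊗-ext {m} {n} λ i j k l → begin
    ((A ⊗ B) ▸ column (C ⊗ D) (combine k l)) (combine i j)
      ≡⟨ ⊗-▸ A B (column (C ⊗ D) (combine k l)) i j ⟩
    (A ▸ (λ k′ → (B ▸ (λ l′ → (C ⊗ D) (combine k′ l′) (combine k l))) j)) i
      ≡⟨ ▸-cong A (λ k′ → trans (▸-cong B (λ l′ → ⊗-combine C D k′ l′ k l) j)
                                (▸-* B (C k′ k) (column D l) j)) i ⟩
    ∑ (λ k′ → A i k′ * (C k′ k * (B · D) j l))
      ≡⟨ ∑-cong (λ k′ → ℤP.*-assoc (A i k′) (C k′ k) ((B · D) j l)) ⟨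
    ∑ (λ k′ → A i k′ * C k′ k * (B · D) j l)
      ≡⟨ ∑-*ʳ ((B · D) j l) (λ k′ → A i k′ * C k′ k) ⟩
    (A · C) i k * (B · D) j l
      ≡⟨ ⊗-combine (A · C) (B · D) i j k l ⟨
    ((A · C) ⊗ (B · D)) (combine i j) (combine k l) ∎
    where open ≡-Reasoning

  ▸-identity⇒≋I : ∀ {n} {A : Mat n} → (∀ x → A ▸ x ≗ x) → A ≋ I n
  ▸-identity⇒≋I {n} {A} A▸x≗x i j = trans (sym (·-identityʳ A i j)) (A▸x≗x (column (I n) j) i)

  I⊗I : ∀ m n → I m ⊗ I n ≋ I (m ℕ.* n)
  I⊗I m n = ▸-identity⇒≋I λ x → ∀-combine {m} {n} λ i j → begin
    ((I m ⊗ I n) ▸ x) (combine i j)                           ≡⟨ ⊗-▸ (I m) (I n) x i j ⟩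
    (I m ▸ (λ k → (I n ▸ (λ l → x (combine k l))) j)) i       ≡⟨ ▸-cong (I m) (λ k → I-▸ (λ l → x (combine k l)) j) i ⟩
    (I m ▸ (λ k → x (combine k j))) i                         ≡⟨ I-▸ (λ k → x (combine k j)) i ⟩
    x (combine i j)                                           ∎
    where open ≡-Reasoning

  sgn-+ : ∀ m n → sgn (m ℕ.+ n) ≡ sgn m * sgn n
  sgn-+ zero    n = sym (ℤP.*-identityˡ (sgn n))
  sgn-+ (suc m) n = trans (cong (-1ℤ *_) (sgn-+ m n)) (sym (ℤP.*-assoc -1ℤ (sgn m) (sgn n)))

  kpow-cong : ∀ b {A B : Mat b} N → A ≋ B → kpow b A N ≋ kpow b B N
  kpow-cong b zero    A≋B i j = refl
  kpow-cong b (suc N) A≋B     = ⊗-cong A≋B (kpow-cong b N A≋B)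

  kpow-transpose : ∀ b (A : Mat b) N → transpose (kpow b A N) ≋ kpow b (transpose A) N
  kpow-transpose b A zero    zero zero = refl
  kpow-transpose b A (suc N) =
    ≋-trans (⊗-transpose A (kpow b A N)) (⊗-cong (≋-refl {A = transpose A}) (kpow-transpose b A N))

  kpow-· : ∀ b (A B : Mat b) N → kpow b A N · kpow b B N ≋ kpow b (A · B) N
  kpow-· b A B zero    = ·-identityˡ (I 1)
  kpow-· b A B (suc N) =
    ≋-trans (⊗-· A B (kpow b A N) (kpow b B N)) (⊗-cong (≋-refl {A = A · B}) (kpow-· b A B N))

  kpow-I : ∀ b N → kpow b (I b) N ≋ I (b ℕ.^ N)
  kpow-I b zero    = ≋-refl
  kpow-I b (suc N) = ≋-trans (⊗-cong (≋-refl {A = I b}) (kpow-I b N)) (I⊗I b (b ℕ.^ N))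

  kpow-^ : ∀ b (A : Mat b) N k → kpow b A N ^ k ≋ kpow b (A ^ k) N
  kpow-^ b A N zero    = ≋-sym (kpow-I b N)
  kpow-^ b A N (suc k) =
    ≋-trans (·-congˡ (kpow b A N) (kpow-^ b A N k)) (kpow-· b A (A ^ k) N)

  kpow-sgn : ∀ b k N → kpow b (sgn k • I b) N ≋ sgn (N ℕ.* k) • I (b ℕ.^ N)
  kpow-sgn b k zero    i j = sym (ℤP.*-identityˡ (I 1 i j))
  kpow-sgn b k (suc N)     = begin
    (sgn k • I b) ⊗ kpow b (sgn k • I b) N         ≈⟨ ⊗-cong (≋-refl {A = sgn k • I b}) (kpow-sgn b k N) ⟩
    (sgn k • I b) ⊗ (sgn (N ℕ.* k) • I (b ℕ.^ N))  ≈⟨ •-⊗-• (sgn k) (sgn (N ℕ.* k)) (I b) (I (b ℕ.^ N)) ⟩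
    (sgn k * sgn (N ℕ.* k)) • (I b ⊗ I (b ℕ.^ N))  ≈⟨ (λ i j → cong₂ _*_ (sym (sgn-+ k (N ℕ.* k))) (I⊗I b (b ℕ.^ N) i j)) ⟩
    sgn (k ℕ.+ N ℕ.* k) • I (b ℕ.* b ℕ.^ N)         ∎
    where open ≋-Reasoning

  kpow-power : ∀ b {A : Mat b} {k} N {X : Mat (b ℕ.^ N)} →
               A ^ k ≋ sgn k • I b → X ≋ kpow b A N → X ^ k ≋ sgn (N ℕ.* k) • I (b ℕ.^ N)
  kpow-power b {A} {k} N {X} Aᵏ≋ X≋ = begin
    X ^ k                 ≈⟨ ^-cong k X≋ ⟩
    kpow b A N ^ k        ≈⟨ kpow-^ b A N k ⟩
    kpow b (A ^ k) N      ≈⟨ kpow-cong b N Aᵏ≋ ⟩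
    kpow b (sgn k • I b) N ≈⟨ kpow-sgn b k N ⟩
    sgn (N ℕ.* k) • I (b ℕ.^ N) ∎
    where open ≋-Reasoning

  -- The factors U₁ and V₁

  U₁ : ∀ b → Mat b
  U₁ b = S₁ b · transpose (M₁ b)

  V₁ : ∀ b → Mat b
  V₁ b = transpose (M₁ b) · S₁ b

  U≋kpow-U₁ : ∀ b N → U b N ≋ kpow b (U₁ b) N
  U≋kpow-U₁ b N = ≋-trans (·-congˡ (S b N) (kpow-transpose b (M₁ b) N))
                          (kpow-· b (S₁ b) (transpose (M₁ b)) N)

  V≋kpow-V₁ : ∀ b N → V b N ≋ kpow b (V₁ b) N
  V≋kpow-V₁ b N = ≋-trans (·-congʳ (S b N) (kpow-transpose b (M₁ b) N))
                          (kpow-· b (transpose (M₁ b)) (S₁ b) N)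

  M₁ᵀ-▸ : ∀ {b} (z : ℕ → ℤ) → z b ≡ 0ℤ → ∀ i →
          (transpose (M₁ b) ▸ (z ∘ toℕ)) i ≡ z (toℕ i) - z (suc (toℕ i))
  M₁ᵀ-▸ {suc b} z z[b]≡0 zero = cong₂ _+_ (ℤP.*-identityˡ (z 0)) (subdiagonal b z z[b]≡0)
    where
    subdiagonal : ∀ b (z : ℕ → ℤ) → z (suc b) ≡ 0ℤ →
                  ∑ (λ (l : Fin b) → M₁ (suc b) (suc l) zero * z (suc (toℕ l))) ≡ - z 1
    subdiagonal zero    z z[1]≡0 = sym (cong -_ z[1]≡0)
    subdiagonal (suc b) z _      = begin
      -1ℤ * z 1 + ∑ (λ (l : Fin b) → 0ℤ * z (2 ℕ.+ toℕ l)) ≡⟨ cong (-1ℤ * z 1 +_) (∑-zero (λ (l : Fin b) → z (2 ℕ.+ toℕ l))) ⟩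
      -1ℤ * z 1 + 0ℤ                              ≡⟨ ℤP.+-identityʳ (-1ℤ * z 1) ⟩
      -1ℤ * z 1                                   ≡⟨ ℤP.-1*i≡-i (z 1) ⟩
      - z 1                                       ∎
      where open ≡-Reasoning
  M₁ᵀ-▸ {suc b} z z[b]≡0 (suc i) = begin
    0ℤ * z 0 + (transpose (M₁ b) ▸ (z ∘ suc ∘ toℕ)) i ≡⟨ cong₂ _+_ (ℤP.*-zeroˡ (z 0)) (M₁ᵀ-▸ (z ∘ suc) z[b]≡0 i) ⟩
    0ℤ + (z (suc (toℕ i)) - z (2 ℕ.+ toℕ i))          ≡⟨ ℤP.+-identityˡ _ ⟩
    z (suc (toℕ i)) - z (2 ℕ.+ toℕ i)                 ∎
    where open ≡-Reasoning

  S₁-▸-telescope : ∀ {b} (z : ℕ → ℤ) i →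
                   (S₁ b ▸ (λ l → z (toℕ l) - z (suc (toℕ l)))) i ≡ z 0 - z (suc (toℕ i))
  S₁-▸-telescope {suc b} z zero = begin
    1ℤ * (z 0 - z 1) + ∑ (λ (l : Fin b) → 0ℤ * (z (suc (toℕ l)) - z (2 ℕ.+ toℕ l)))
      ≡⟨ cong₂ _+_ (ℤP.*-identityˡ (z 0 - z 1)) (∑-zero (λ (l : Fin b) → z (suc (toℕ l)) - z (2 ℕ.+ toℕ l))) ⟩
    z 0 - z 1 + 0ℤ
      ≡⟨ ℤP.+-identityʳ (z 0 - z 1) ⟩
    z 0 - z 1 ∎
    where open ≡-Reasoning
  S₁-▸-telescope {suc b} z (suc i) = begin
    1ℤ * (z 0 - z 1) + (S₁ b ▸ (λ l → z (suc (toℕ l)) - z (2 ℕ.+ toℕ l))) i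
      ≡⟨ cong (1ℤ * (z 0 - z 1) +_) (S₁-▸-telescope (z ∘ suc) i) ⟩
    1ℤ * (z 0 - z 1) + (z 1 - z (2 ℕ.+ toℕ i))
      ≡⟨ collapse (z 0) (z 1) (z (2 ℕ.+ toℕ i)) ⟩
    z 0 - z (2 ℕ.+ toℕ i) ∎
    where
    open ≡-Reasoning
    collapse : ∀ a b c → 1ℤ * (a - b) + (b - c) ≡ a - c
    collapse = solve-∀

  U₁-▸ : ∀ {b} (z : ℕ → ℤ) → z b ≡ 0ℤ → ∀ i → (U₁ b ▸ (z ∘ toℕ)) i ≡ z 0 - z (suc (toℕ i))
  U₁-▸ {b} z z[b]≡0 i = begin
    (U₁ b ▸ (z ∘ toℕ)) i                                 ≡⟨ ·-▸ (S₁ b) (transpose (M₁ b)) (z ∘ toℕ) i ⟩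
    (S₁ b ▸ (transpose (M₁ b) ▸ (z ∘ toℕ))) i            ≡⟨ ▸-cong (S₁ b) (M₁ᵀ-▸ z z[b]≡0) i ⟩
    (S₁ b ▸ (λ l → z (toℕ l) - z (suc (toℕ l)))) i       ≡⟨ S₁-▸-telescope z i ⟩
    z 0 - z (suc (toℕ i))                                ∎
    where open ≡-Reasoning

  -- The class of y ∈ ℤ^{b+1} modulo constant vectors, as the representative with coordinate b equal to 0.
  project : ∀ b → (ℕ → ℤ) → Fin b → ℤ
  project b y i = y (toℕ i) - y b

  project-cong : ∀ b {y y′ : ℕ → ℤ} → y ≗ y′ → project b y ≗ project b y′
  project-cong b y≗y′ i = cong₂ _-_ (y≗y′ (toℕ i)) (y≗y′ b)

  U₁-▸-project : ∀ {b} (y : ℕ → ℤ) → y (suc b) ≡ y 0 →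
                 U₁ b ▸ project b y ≗ λ i → - project b (y ∘ suc) i
  U₁-▸-project {b} y y[1+b]≡y[0] i = begin
    (U₁ b ▸ project b y) i                        ≡⟨ U₁-▸ (λ n → y n - y b) (ℤP.+-inverseʳ (y b)) i ⟩
    (y 0 - y b) - (y (suc (toℕ i)) - y b)         ≡⟨ cancel (y 0) (y b) (y (suc (toℕ i))) ⟩
    - (y (suc (toℕ i)) - y 0)                     ≡⟨ cong (λ t → - (y (suc (toℕ i)) - t)) y[1+b]≡y[0] ⟨
    - (y (suc (toℕ i)) - y (suc b))               ∎
    where
    open ≡-Reasoning
    cancel : ∀ a c d → (a - c) - (d - c) ≡ - (d - a)
    cancel = solve-∀

  Periodic : ℕ → (ℕ → ℤ) → Set
  Periodic p y = ∀ n → y (p ℕ.+ n) ≡ y n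

  U₁^-▸-project : ∀ {b} (y : ℕ → ℤ) → Periodic (suc b) y → ∀ k →
                  (U₁ b ^ k) ▸ project b y ≗ λ i → sgn k * project b (λ n → y (k ℕ.+ n)) i
  U₁^-▸-project {b} y y-periodic zero i =
    trans (I-▸ (project b y) i) (sym (ℤP.*-identityˡ (project b y i)))
  U₁^-▸-project {b} y y-periodic (suc k) i = begin
    ((U₁ b · (U₁ b ^ k)) ▸ project b y) i           ≡⟨ ·-▸ (U₁ b) (U₁ b ^ k) (project b y) i ⟩
    (U₁ b ▸ ((U₁ b ^ k) ▸ project b y)) i           ≡⟨ ▸-cong (U₁ b) (U₁^-▸-project y y-periodic k) i ⟩
    (U₁ b ▸ (λ l → sgn k * project b yₖ l)) i       ≡⟨ ▸-* (U₁ b) (sgn k) (project b yₖ) i ⟩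
    sgn k * (U₁ b ▸ project b yₖ) i                 ≡⟨ cong (sgn k *_) (U₁-▸-project yₖ yₖ-wraps i) ⟩
    sgn k * - project b (yₖ ∘ suc) i                ≡⟨ neg-into-sign (sgn k) (project b (yₖ ∘ suc) i) ⟩
    -1ℤ * sgn k * project b (yₖ ∘ suc) i            ≡⟨ cong (-1ℤ * sgn k *_) (project-cong b (λ n → cong y (ℕP.+-suc k n)) i) ⟩
    -1ℤ * sgn k * project b (λ n → y (suc k ℕ.+ n)) i ∎
    where
    open ≡-Reasoning
    yₖ : ℕ → ℤ
    yₖ n = y (k ℕ.+ n)
    yₖ-wraps : yₖ (suc b) ≡ yₖ 0
    yₖ-wraps = trans (cong y (ℕP.+-comm k (suc b))) (trans (y-periodic k) (cong y (sym (ℕP.+-identityʳ k))))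
    neg-into-sign : ∀ s p → s * - p ≡ -1ℤ * s * p
    neg-into-sign = solve-∀

  cyclicUnit : ∀ b → Fin b → ℕ → ℤ
  cyclicUnit b j n = if n % suc b ℕ.≡ᵇ toℕ j then 1ℤ else 0ℤ

  cyclicUnit-periodic : ∀ {b} (j : Fin b) → Periodic (suc b) (cyclicUnit b j)
  cyclicUnit-periodic {b} j n = cong (λ r → if r ℕ.≡ᵇ toℕ j then 1ℤ else 0ℤ) (%-remove-+ˡ n (∣-refl {suc b}))

  <⇒≡ᵇ-false : ∀ {m n} → m ℕ.< n → (n ℕ.≡ᵇ m) ≡ false
  <⇒≡ᵇ-false {zero}  {suc n} _             = refl
  <⇒≡ᵇ-false {suc m} {suc n} (ℕ.s≤s m<n) = <⇒≡ᵇ-false m<n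

  project-cyclicUnit : ∀ {b} (j : Fin b) → project b (cyclicUnit b j) ≗ column (I b) j
  project-cyclicUnit {b} j l = begin
    project b (cyclicUnit b j) l
      ≡⟨ cong₂ (λ r s → δ r - δ s) (m≤n⇒m%n≡m (ℕP.<⇒≤ (toℕ<n l))) (m≤n⇒m%n≡m (ℕP.≤-refl {b})) ⟩
    δ (toℕ l) - δ b
      ≡⟨ cong (λ t → δ (toℕ l) - (if t then 1ℤ else 0ℤ)) (<⇒≡ᵇ-false (toℕ<n j)) ⟩
    I b l j - 0ℤ
      ≡⟨ ℤP.+-identityʳ (I b l j) ⟩
    I b l j ∎
    where
    open ≡-Reasoning
    δ : ℕ → ℤ
    δ r = if r ℕ.≡ᵇ toℕ j then 1ℤ else 0ℤ

  U₁^[1+b] : ∀ b → U₁ b ^ (b ℕ.+ 1) ≋ sgn (b ℕ.+ 1) • I b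
  U₁^[1+b] b rewrite ℕP.+-comm b 1 = λ i j → begin
    (U₁ b ^ suc b) i j                                    ≡⟨ ·-identityʳ (U₁ b ^ suc b) i j ⟨
    ((U₁ b ^ suc b) ▸ column (I b) j) i                   ≡⟨ ▸-cong (U₁ b ^ suc b) (λ l → sym (project-cyclicUnit j l)) i ⟩
    ((U₁ b ^ suc b) ▸ project b (cyclicUnit b j)) i       ≡⟨ U₁^-▸-project (cyclicUnit b j) (cyclicUnit-periodic j) (suc b) i ⟩
    sgn (suc b) * project b (λ n → cyclicUnit b j (suc b ℕ.+ n)) i
      ≡⟨ cong (sgn (suc b) *_) (project-cong b (cyclicUnit-periodic j) i) ⟩
    sgn (suc b) * project b (cyclicUnit b j) i            ≡⟨ cong (sgn (suc b) *_) (project-cyclicUnit j i) ⟩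
    sgn (suc b) * I b i j                                 ∎
    where open ≡-Reasoning

  indicator-≤-step : ∀ m n → (if n ℕ.<ᵇ m then 0ℤ else 1ℤ) - (if n ℕ.<ᵇ suc m then 0ℤ else 1ℤ)
                             ≡ (if m ℕ.≡ᵇ n then 1ℤ else 0ℤ)
  indicator-≤-step zero    zero    = refl
  indicator-≤-step zero    (suc n) = refl
  indicator-≤-step (suc m) zero    = refl
  indicator-≤-step (suc m) (suc n) = indicator-≤-step m n

  M₁ᵀ·S₁ᵀ≋I : ∀ b → transpose (M₁ b) · transpose (S₁ b) ≋ I b
  M₁ᵀ·S₁ᵀ≋I b i j = trans (M₁ᵀ-▸ atMost-j atMost-j[b]≡0 i) (indicator-≤-step (toℕ i) (toℕ j))
    where
    atMost-j : ℕ → ℤ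
    atMost-j n = if toℕ j ℕ.<ᵇ n then 0ℤ else 1ℤ
    atMost-j[b]≡0 : atMost-j b ≡ 0ℤ
    atMost-j[b]≡0 = cong (λ t → if t then 0ℤ else 1ℤ) (Equivalence.to T-≡ (ℕP.<⇒<ᵇ (toℕ<n j)))

  V₁^[1+b] : ∀ b → V₁ b ^ (b ℕ.+ 1) ≋ sgn (b ℕ.+ 1) • I b
  V₁^[1+b] b = ^-similar {A = V₁ b} {U₁ b} {transpose (M₁ b)} {c = sgn (b ℕ.+ 1)} {k = b ℕ.+ 1}
    (·-assoc (transpose (M₁ b)) (S₁ b) (transpose (M₁ b))) (M₁ᵀ·S₁ᵀ≋I b) (U₁^[1+b] b)

open import Data.Nat using (ℕ; _≤_; _+_; _*_) renaming (_^_ to _^ℕ_)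
open import Data.Product using (_×_; _,_)
open import Relation.Binary.PropositionalEquality using (_≡_)

theorem4p3 : (b N : ℕ) → 2 ≤ b → 1 ≤ N →
    (∀ i j → (U b N ^ (b + 1)) i j ≡ (sgn (N * (b + 1)) • I (b ^ℕ N)) i j) ×
    (∀ i j → (V b N ^ (b + 1)) i j ≡ (sgn (N * (b + 1)) • I (b ^ℕ N)) i j)
-- The identity holds for all b and N.
theorem4p3 b N _ _ = kpow-power b N (U₁^[1+b] b) (U≋kpow-U₁ b N)
                   , kpow-power b N (V₁^[1+b] b) (V≋kpow-V₁ b N)
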